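{- If there is a derivation $e;\,C;\,\sigma;\,\delta\Longrightarrow^*e';\,\emptyset;\,\sigma';\,\delta'$ using the rules of BQNarrow, then for every equation $s=t\in C$ we have $s\sigma'=t\sigma'$.
   Context: $\mathbb{\Omega}=(\Omega,\precsim,\otimes,\kappa)$ is a fixed Lawverean quantale (commutative monoid with complete lattice order, $\otimes$ distributing over arbitrary joins, $\kappa$ top, $\kappa\neq\bot$, cointegral). A CBE is a monotone map $\Omega\to\Omega$ preserving $\kappa$, $\otimes$ and arbitrary joins; $\mathbb{\Phi}$ is a fixed set of CBEs containing identity and the constant map $\kappa^\star$, closed under composition and pointwise $\otimes$. A $\mathbb{\Phi}$-graded signature gives each $n$-ary $f$ a modal arity $(\phi_1,\dots,\phi_n)\in\Phi^n$; grade of a position: $\partial_\lambda(t)=\mathbb{1}$, $\partial_{i.p}(f(t_1,\dots,t_n))=\phi_i\circ\partial_p(t_i)$. An $(\mathbb{\Omega},\mathbb{\Phi})$-TRS $\mathcal{R}=(\mathcal{F},R)$ is fixed: a graded signature with rules $\varepsilon\Vdash l\mapsto r$, $l\notin\mathcal{V}$, $\mathcal{V}(r)\subseteq\mathcal{V}(l)$. The signature is extended by a constant $\textsc{true}$ and binary $=^?$ of modal arity $(\mathbb{1},\mathbb{1})$. BQNarrow operates on configurations $e;C;\sigma;\delta$ ($e$ a term, $C$ a set of equations, $\sigma$ a substitution, $\delta\in\Omega$): (LP) $e[t]_p;C;\sigma;\delta\Longrightarrow e[r]_p;\{l\sigma=t\sigma\}\cup C;\sigma;\delta\otimes\partial_p(e)(\varepsilon)$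 for $e\neq\textsc{true}$, $p$ a non-variable position of $e$, $\varepsilon\Vdash l\mapsto r$ a variant of a rule of $R$ with fresh variables; (SU) $e;C;\sigma;\delta\Longrightarrow e;\emptyset;\sigma\rho;\delta$ for $C\ne\emptyset$, $\rho$ a most general unifier of $C$ ($\sigma\rho$ applies $\sigma$ first); (Cla) $e;C;\sigma;\delta\Longrightarrow\mathbf{F}$ if $C$ is not unifiable; (Con) $e;C;\sigma;\delta\Longrightarrow\textsc{true};C\cup\{e\sigma\};\sigma;\delta$ for $e\ne\textsc{true}$ (a term $u=^?v$ read as equation $u=v$). It is a convention of the calculus that the most general unifiers are chosen so that the substitution built in the configuration is always well-defined and idempotent, with the range of each chosen mgu consisting of fresh variables. $\Longrightarrow^*$: a finite sequence of steps. -}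

module Defs where

open import Level using () renaming (zero to lzero)
open import Data.Nat using (ℕ; zero; suc)
open import Data.Empty using (⊥)
open import Data.Sum using (_⊎_)
open import Data.Product using (Σ; Σ-syntax; ∃; ∃-syntax; _×_; _,_)
open import Data.List using (List; []; _∷_)
open import Data.List.Membership.Propositional using (_∈_)
open import Data.Maybe using (Maybe; just; nothing)
open import Data.Vec using (Vec; []; _∷_)
open import Data.Vec.Relation.Unary.All using (All)
open import Function using (_∘_; id; const)
open import Function.Definitions using (Injective)
open import Relation.Nullary using (¬_)
open import Relation.Binary.PropositionalEquality using (_≡_; _≢_)
open import Relation.Binary.Structures using (IsPartialOrder)
open import Relation.Binary.Construct.Closure.ReflexiveTransitive using (Star)
open import Algebra.Structures using (IsCommutativeMonoid)

record Quantale : Set₁ where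
  infixl 7 _⊗_
  field
    Ω         : Set
    _≼_       : Ω → Ω → Set
    ≼-isPartialOrder : IsPartialOrder _≡_ _≼_
    ⋁         : {I : Set} → (I → Ω) → Ω
    ⋁-upper   : ∀ {I : Set} (f : I → Ω) (i : I) → f i ≼ ⋁ f
    ⋁-least   : ∀ {I : Set} (f : I → Ω) (u : Ω) → (∀ i → f i ≼ u) → ⋁ f ≼ u
    _⊗_       : Ω → Ω → Ω
    κ         : Ω
    ⊗-isCommutativeMonoid : IsCommutativeMonoid _≡_ _⊗_ κ
    -- ⊗ distributes over arbitrary joins (right distributivity follows by commutativity)
    ⊗-distrib-⋁ : ∀ (a : Ω) {I : Set} (f : I → Ω) → a ⊗ ⋁ f ≡ ⋁ (λ i → a ⊗ f i)

  ⊥Ω : Ω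
  ⊥Ω = ⋁ {⊥} (λ ())

  field
    κ-top      : ∀ (a : Ω) → a ≼ κ
    κ≢⊥        : κ ≢ ⊥Ω
    cointegral : ∀ (a b : Ω) → a ⊗ b ≡ ⊥Ω → (a ≡ ⊥Ω) ⊎ (b ≡ ⊥Ω)

module _ (Q : Quantale) where
  open Quantale Q

  record IsCBE (φ : Ω → Ω) : Set₁ where
    field
      monotone  : ∀ {a b} → a ≼ b → φ a ≼ φ b
      pres-κ    : φ κ ≡ κ
      pres-⊗    : ∀ a b → φ (a ⊗ b) ≡ φ a ⊗ φ b
      pres-⋁    : ∀ {I : Set} (f : I → Ω) → I → φ (⋁ f) ≡ ⋁ (φ ∘ f)

  record Grading : Set₁ where
    field
      Φ      : (Ω → Ω) → Set
      Φ-CBE  : ∀ {φ} → Φ φ → IsCBE φ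
      Φ-id   : Φ id
      Φ-κ⋆   : Φ (const κ)
      Φ-∘    : ∀ {φ ψ} → Φ φ → Φ ψ → Φ (φ ∘ ψ)
      Φ-⊗    : ∀ {φ ψ} → Φ φ → Φ ψ → Φ (λ a → φ a ⊗ ψ a)

  record GradedSignature (G : Grading) : Set₁ where
    field
      F        : Set
      arity    : F → ℕ
      marity   : (f : F) → Vec (Ω → Ω) (arity f)
      marity-Φ : (f : F) → All (Grading.Φ G) (marity f)

module Terms (Q : Quantale) (G : Grading Q) (S : GradedSignature Q G) where
  open Quantale Q
  open GradedSignature S

  data Sym : Set where
    base  : F → Sym
    trueS : Sym
    eqS   : Sym

  ar : Sym → ℕ
  ar (base f) = arity f
  ar trueS    = 0
  ar eqS      = 2

  mar : (s : Sym) → Vec (Ω → Ω) (ar s)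
  mar (base f) = marity f
  mar trueS    = []
  mar eqS      = id ∷ id ∷ []

  Var : Set
  Var = ℕ

  data Term : Set where
    var : Var → Term
    fun : (s : Sym) → Vec Term (ar s) → Term

  TRUE : Term
  TRUE = fun trueS []

  _=?_ : Term → Term → Term
  u =? v = fun eqS (u ∷ v ∷ [])

  mutual
    data _occ_ (x : Var) : Term → Set where
      here : x occ var x
      args : ∀ {s ts} → x occVec ts → x occ fun s ts

    data _occVec_ (x : Var) : ∀ {n} → Vec Term n → Set where
      hd : ∀ {n t} {ts : Vec Term n} → x occ t → x occVec (t ∷ ts)
      tl : ∀ {n t} {ts : Vec Term n} → x occVec ts → x occVec (t ∷ ts)

  mutual
    data BaseTerm : Term → Set where
      var : ∀ x → BaseTerm (var x)
      fun : ∀ f {ts} → BaseVec ts → BaseTerm (fun (base f) ts)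

    data BaseVec : ∀ {n} → Vec Term n → Set where
      []  : BaseVec []
      _∷_ : ∀ {n t} {ts : Vec Term n} → BaseTerm t → BaseVec ts → BaseVec (t ∷ ts)

  -- substitutions (total maps; the domain is where they act non-trivially)
  Subst : Set
  Subst = Var → Term

  mutual
    _⟨_⟩ : Term → Subst → Term
    var x ⟨ σ ⟩    = σ x
    fun s ts ⟨ σ ⟩ = fun s (ts ⟨ σ ⟩*)

    _⟨_⟩* : ∀ {n} → Vec Term n → Subst → Vec Term n
    [] ⟨ σ ⟩*       = []
    (t ∷ ts) ⟨ σ ⟩* = (t ⟨ σ ⟩) ∷ (ts ⟨ σ ⟩*)

  -- σρ : apply σ first, then ρ
  _⨾_ : Subst → Subst → Subst
  (σ ⨾ ρ) x = σ x ⟨ ρ ⟩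

  InDom : Subst → Var → Set
  InDom σ x = σ x ≢ var x

  Idempotent : Subst → Set
  Idempotent σ = ∀ x → σ x ⟨ σ ⟩ ≡ σ x

  -- positions (lists of argument indices, 0-based), subterms, replacement, grades
  Pos : Set
  Pos = List ℕ

  mutual
    _∣_ : Term → Pos → Maybe Term
    t ∣ []                = just t
    var x ∣ (i ∷ p)       = nothing
    fun s ts ∣ (i ∷ p)    = subVec ts i p

    subVec : ∀ {n} → Vec Term n → ℕ → Pos → Maybe Term
    subVec [] i p             = nothing
    subVec (t ∷ ts) zero p    = t ∣ p
    subVec (t ∷ ts) (suc i) p = subVec ts i p

  mutual
    _[_]≔_ : Term → Pos → Term → Term
    t [ [] ]≔ u             = u
    var x [ i ∷ p ]≔ u      = var x
    fun s ts [ i ∷ p ]≔ u   = fun s (repVec ts i p u)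

    repVec : ∀ {n} → Vec Term n → ℕ → Pos → Term → Vec Term n
    repVec [] i p u             = []
    repVec (t ∷ ts) zero p u    = (t [ p ]≔ u) ∷ ts
    repVec (t ∷ ts) (suc i) p u = t ∷ repVec ts i p u

  -- ∂_p(t) ; meaningful for positions p of t
  mutual
    ∂ : Pos → Term → (Ω → Ω)
    ∂ [] t              = id
    ∂ (i ∷ p) (var x)   = id
    ∂ (i ∷ p) (fun s ts) = ∂Vec i p ts (mar s)

    ∂Vec : ∀ {n} → ℕ → Pos → Vec Term n → Vec (Ω → Ω) n → (Ω → Ω)
    ∂Vec i p [] []                   = id
    ∂Vec zero p (t ∷ ts) (φ ∷ φs)    = φ ∘ ∂ p t
    ∂Vec (suc i) p (t ∷ ts) (φ ∷ φs) = ∂Vec i p ts φs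

  Equation : Set
  Equation = Term × Term

  Eqs : Set
  Eqs = List Equation

  Unifier : Subst → Eqs → Set
  Unifier ρ C = ∀ {s t} → (s , t) ∈ C → s ⟨ ρ ⟩ ≡ t ⟨ ρ ⟩

  Unifiable : Eqs → Set
  Unifiable C = Σ[ θ ∈ Subst ] Unifier θ C

  _occEqs_ : Var → Eqs → Set
  x occEqs C = ∃[ s ] ∃[ t ] ((s , t) ∈ C × (x occ s ⊎ x occ t))

  -- most general unifier (generality measured on the variables of C)
  MGU : Subst → Eqs → Set
  MGU ρ C = Unifier ρ C ×
            (∀ θ → Unifier θ C → Σ[ η ∈ Subst ] (∀ x → x occEqs C → θ x ≡ ρ x ⟨ η ⟩))

  record Rule : Set where
    constructor _⊩_↦_
    field
      weight : Ω
      lhs    : Term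
      rhs    : Term

record TRS (Q : Quantale) (G : Grading Q) (S : GradedSignature Q G) : Set₁ where
  open Terms Q G S
  field
    R         : Rule → Set
    lhs-nonvar : ∀ {ρ} → R ρ → ∃[ s ] ∃[ ts ] (Rule.lhs ρ ≡ fun s ts)
    vars-rhs  : ∀ {ρ} → R ρ → ∀ x → x occ Rule.rhs ρ → x occ Rule.lhs ρ
    lhs-base  : ∀ {ρ} → R ρ → BaseTerm (Rule.lhs ρ)
    rhs-base  : ∀ {ρ} → R ρ → BaseTerm (Rule.rhs ρ)

module BQNarrow (Q : Quantale) (G : Grading Q) (S : GradedSignature Q G)
                (T : TRS Q G S) where
  open Quantale Q
  open Terms Q G S public
  open TRS T

  record Config : Set where
    constructor ⟪_,_,_,_⟫
    field
      term   : Term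
      eqs    : Eqs
      subst  : Subst
      degree : Ω

  data Result : Set where
    cfg : Config → Result
    𝐅   : Result

  OccursIn : Var → Config → Set
  OccursIn x ⟪ e , C , σ , δ ⟫ =
    x occ e ⊎ x occEqs C ⊎ InDom σ x ⊎ (∃[ y ] (InDom σ y × x occ σ y))

  FreshVariant : Rule → Rule → Config → Set
  FreshVariant r r' c =
    (Σ[ π ∈ (Var → Var) ] Injective _≡_ _≡_ π ×
       Rule.weight r' ≡ Rule.weight r ×
       Rule.lhs r' ≡ Rule.lhs r ⟨ var ∘ π ⟩ ×
       Rule.rhs r' ≡ Rule.rhs r ⟨ var ∘ π ⟩) ×
    (∀ x → x occ Rule.lhs r' → ¬ OccursIn x c)

  -- conventions on the chosen mgu in (SU): the range consists of fresh variables,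
  -- the resulting substitution σρ is well-defined (dom ρ ∩ dom σ = ∅) and idempotent
  MGUConvention : Subst → Config → Set
  MGUConvention ρ c@(⟪ e , C , σ , δ ⟫) =
    (∀ x y → InDom ρ x → y occ ρ x → ¬ OccursIn y c) ×
    (∀ x → InDom ρ x → ¬ InDom σ x) ×
    Idempotent (σ ⨾ ρ)

  infix 4 _⟹_ _⟹*_
  data _⟹_ : Result → Result → Set where
    LP  : ∀ {e C σ δ} (p : Pos) {t : Term} (r r' : Rule) →
          e ≢ TRUE →
          e ∣ p ≡ just t →
          (∃[ s ] ∃[ ts ] (t ≡ fun s ts)) →
          R r →
          FreshVariant r r' ⟪ e , C , σ , δ ⟫ →
          cfg ⟪ e , C , σ , δ ⟫ ⟹
          cfg ⟪ e [ p ]≔ Rule.rhs r'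
              , (Rule.lhs r' ⟨ σ ⟩ , t ⟨ σ ⟩) ∷ C
              , σ
              , δ ⊗ ∂ p e (Rule.weight r') ⟫
    SU  : ∀ {e C σ δ} (ρ : Subst) →
          C ≢ [] →
          MGU ρ C →
          MGUConvention ρ ⟪ e , C , σ , δ ⟫ →
          cfg ⟪ e , C , σ , δ ⟫ ⟹ cfg ⟪ e , [] , σ ⨾ ρ , δ ⟫
    Cla : ∀ {e C σ δ} →
          ¬ Unifiable C →
          cfg ⟪ e , C , σ , δ ⟫ ⟹ 𝐅
    Con : ∀ {e C σ δ u v} →
          e ≢ TRUE →
          e ⟨ σ ⟩ ≡ u =? v →
          cfg ⟪ e , C , σ , δ ⟫ ⟹ cfg ⟪ TRUE , (u , v) ∷ C , σ , δ ⟫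

  _⟹*_ : Result → Result → Set
  _⟹*_ = Star _⟹_

{-# OPTIONS --safe #-}
-- An equation leaves the constraint set only through (SU), which replaces σ by σρ for a
-- unifier ρ of the constraints. Since dom ρ and dom σ are disjoint and σρ is idempotent,
-- σρ = ρ(σρ), so σρ is itself a unifier; every later step keeps the substitution or
-- post-composes it with an mgu, and unifiers are closed under post-composition.
module Submission where

open import Defs
open import Data.Product using (_,_)
open import Data.List using ([])
open import Data.List.Membership.Propositional using (_∈_)
open import Data.List.Relation.Unary.Any using (there)
open import Data.Vec using (Vec; []; _∷_)
open import Data.Nat using (_≟_)
open import Data.Sum using (_⊎_; inj₁; inj₂)
open import Data.Empty using (⊥-elim)
open import Relation.Nullary using (¬_; yes; no)
open import Relation.Binary.PropositionalEquality
  using (_≡_; _≗_; refl; sym; trans; cong; cong₂; module ≡-Reasoning)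
open import Relation.Binary.Construct.Closure.ReflexiveTransitive using (ε; _◅_)

module Substitution (Q : Quantale) (G : Grading Q) (S : GradedSignature Q G) where
  open Terms Q G S

  mutual
    ⟨⟩-⨾ : ∀ (t : Term) σ ρ → t ⟨ σ ⨾ ρ ⟩ ≡ (t ⟨ σ ⟩) ⟨ ρ ⟩
    ⟨⟩-⨾ (var x)    σ ρ = refl
    ⟨⟩-⨾ (fun s ts) σ ρ = cong (fun s) (⟨⟩*-⨾ ts σ ρ)

    ⟨⟩*-⨾ : ∀ {n} (ts : Vec Term n) σ ρ → ts ⟨ σ ⨾ ρ ⟩* ≡ (ts ⟨ σ ⟩*) ⟨ ρ ⟩*
    ⟨⟩*-⨾ []       σ ρ = refl
    ⟨⟩*-⨾ (t ∷ ts) σ ρ = cong₂ _∷_ (⟨⟩-⨾ t σ ρ) (⟨⟩*-⨾ ts σ ρ)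

  mutual
    ⟨⟩-cong : ∀ (t : Term) {σ τ} → σ ≗ τ → t ⟨ σ ⟩ ≡ t ⟨ τ ⟩
    ⟨⟩-cong (var x)    σ≗τ = σ≗τ x
    ⟨⟩-cong (fun s ts) σ≗τ = cong (fun s) (⟨⟩*-cong ts σ≗τ)

    ⟨⟩*-cong : ∀ {n} (ts : Vec Term n) {σ τ} → σ ≗ τ → ts ⟨ σ ⟩* ≡ ts ⟨ τ ⟩*
    ⟨⟩*-cong []       σ≗τ = refl
    ⟨⟩*-cong (t ∷ ts) σ≗τ = cong₂ _∷_ (⟨⟩-cong t σ≗τ) (⟨⟩*-cong ts σ≗τ)

  Unifier-⨾ʳ : ∀ {σ C} θ → Unifier σ C → Unifier (σ ⨾ θ) C
  Unifier-⨾ʳ {σ} θ unif {s} {t} s≐t = begin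
    s ⟨ σ ⨾ θ ⟩      ≡⟨ ⟨⟩-⨾ s σ θ ⟩
    (s ⟨ σ ⟩) ⟨ θ ⟩  ≡⟨ cong (_⟨ θ ⟩) (unif s≐t) ⟩
    (t ⟨ σ ⟩) ⟨ θ ⟩  ≡⟨ ⟨⟩-⨾ t σ θ ⟨
    t ⟨ σ ⨾ θ ⟩      ∎
    where open ≡-Reasoning

  Unifier-resp-≗ : ∀ {σ τ C} → σ ≗ τ → Unifier σ C → Unifier τ C
  Unifier-resp-≗ σ≗τ unif {s} {t} s≐t =
    trans (sym (⟨⟩-cong s σ≗τ)) (trans (unif s≐t) (⟨⟩-cong t σ≗τ))

  var-or-InDom : ∀ σ x → σ x ≡ var x ⊎ InDom σ x
  var-or-InDom σ x with σ x
  ... | fun s ts = inj₂ (λ ())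
  ... | var y with y ≟ x
  ...   | yes refl = inj₁ refl
  ...   | no y≢x   = inj₂ (λ { refl → y≢x refl })

  ⨾-absorbsˡ : ∀ {σ ρ} → (∀ x → InDom ρ x → ¬ InDom σ x) → Idempotent (σ ⨾ ρ) →
               ρ ⨾ (σ ⨾ ρ) ≗ σ ⨾ ρ
  ⨾-absorbsˡ {σ} {ρ} disjoint idempotent x with var-or-InDom ρ x | var-or-InDom σ x
  ... | inj₁ ρx≡x | _          = cong (_⟨ σ ⨾ ρ ⟩) ρx≡x
  ... | inj₂ x∈ρ  | inj₂ x∈σ   = ⊥-elim (disjoint x x∈ρ x∈σ)
  ... | inj₂ _    | inj₁ σx≡x  = begin
    ρ x ⟨ σ ⨾ ρ ⟩            ≡⟨ cong (_⟨ σ ⨾ ρ ⟩) σρx≡ρx ⟨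
    (σ ⨾ ρ) x ⟨ σ ⨾ ρ ⟩      ≡⟨ idempotent x ⟩
    (σ ⨾ ρ) x                ∎
    where
      open ≡-Reasoning
      σρx≡ρx : (σ ⨾ ρ) x ≡ ρ x
      σρx≡ρx = cong (_⟨ ρ ⟩) σx≡x

module Narrowing (Q : Quantale) (G : Grading Q) (S : GradedSignature Q G)
                 (T : TRS Q G S) where
  open BQNarrow Q G S T
  open Substitution Q G S

  ⟹*-preserves-Unifier : ∀ {e C σ δ e' C' σ' δ' D} →
    cfg ⟪ e , C , σ , δ ⟫ ⟹* cfg ⟪ e' , C' , σ' , δ' ⟫ → Unifier σ D → Unifier σ' D
  ⟹*-preserves-Unifier ε                             unif = unif
  ⟹*-preserves-Unifier (LP _ _ _ _ _ _ _ _ ◅ steps) unif = ⟹*-preserves-Unifier steps unif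
  ⟹*-preserves-Unifier (SU ρ _ _ _ ◅ steps)         unif =
    ⟹*-preserves-Unifier steps (Unifier-⨾ʳ ρ unif)
  ⟹*-preserves-Unifier (Cla _ ◅ () ◅ _)             unif
  ⟹*-preserves-Unifier (Con _ _ ◅ steps)            unif = ⟹*-preserves-Unifier steps unif

  ⟹*-solves : ∀ {e C σ δ e' σ' δ'} →
    cfg ⟪ e , C , σ , δ ⟫ ⟹* cfg ⟪ e' , [] , σ' , δ' ⟫ → Unifier σ' C
  ⟹*-solves ε ()
  ⟹*-solves (LP _ _ _ _ _ _ _ _ ◅ steps) s≐t = ⟹*-solves steps (there s≐t)
  ⟹*-solves (Con _ _ ◅ steps)            s≐t = ⟹*-solves steps (there s≐t)
  ⟹*-solves (Cla _ ◅ () ◅ _)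
  ⟹*-solves (SU _ _ (ρ-unifies , _) (_ , disjoint , idempotent) ◅ steps) =
    ⟹*-preserves-Unifier steps
      (Unifier-resp-≗ (⨾-absorbsˡ disjoint idempotent) (Unifier-⨾ʳ _ ρ-unifies))

lemma6 : (Q : Quantale) (G : Grading Q) (S : GradedSignature Q G) (T : TRS Q G S) →
    let open BQNarrow Q G S T in
    ∀ {e C σ δ e' σ' δ'} →
    cfg ⟪ e , C , σ , δ ⟫ ⟹* cfg ⟪ e' , [] , σ' , δ' ⟫ →
    ∀ {s t} → (s , t) ∈ C → s ⟨ σ' ⟩ ≡ t ⟨ σ' ⟩
lemma6 Q G S T = ⟹*-solves
  where open Narrowing Q G S T
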